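{- For every $\varphi\in \mathcal{P}(\Box\!\!\rightarrow)_{\sigma}$, there is an equivalent $\varphi'\in \mathcal{P}(\Box\!\!\rightarrow)_{\sigma}$ such that $\Box\!\!\rightarrow$ only occurs inside probability statements.
   Context: $\mathcal{PCO}_\sigma$ is the language over signature $\sigma$ built from $\mathcal{CO}$ literals $Y=y$, $Y\neq y$ and probabilistic atoms $\Pr(\alpha)\geq\epsilon$, $\Pr(\alpha)>\epsilon$, $\Pr(\alpha)\geq\Pr(\beta)$, $\Pr(\alpha)>\Pr(\beta)$ ($\alpha,\beta\in\mathcal{CO}$), closed under $\land$, global disjunction $\sqcup$, selective implication $\alpha\supset\varphi$ and interventionist counterfactual $\mathbf X=\mathbf x\,\Box\!\!\rightarrow\varphi$ (true in a causal multiteam iff $\varphi$ holds in the causal multiteam obtained by the intervention setting $\mathbf X$ to $\mathbf x$ and recomputing the other endogenous variables by the recursive structural equations). $\mathcal P(\Box\!\!\rightarrow)_\sigma$ is the fragment without $\supset$ (at the outer level). Equivalence means satisfaction by the same causal multiteams of signature $\sigma$.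
   Formalization: The thresholds ε of the probabilistic atoms $\Pr(\alpha)\geq\epsilon$ and $\Pr(\alpha)>\epsilon$ are rationals in [0,1]. -}

module Defs where

open import Data.Nat using (ℕ; zero; suc; _≤_)
open import Data.Fin using (Fin)
open import Data.Fin.Subset using (Subset; _∈_)
open import Data.Bool using (Bool; true; false; not; _∧_; _∨_)
open import Data.Maybe using (Maybe; just; nothing)
open import Data.List using (List; []; _∷_; map; length; filterᵇ)
open import Data.List.Relation.Unary.All using (All)
open import Data.Product using (Σ; ∃; _×_; _,_)
open import Data.Sum using (_⊎_)
open import Data.Unit using (⊤)
open import Data.Empty using (⊥)
open import Data.Integer using (+_)
import Data.Rational as ℚ
open import Data.Rational using (ℚ; 0ℚ; 1ℚ)
open import Relation.Binary.PropositionalEquality using (_≡_; _≢_; refl)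
open import Relation.Nullary.Decidable using (⌊_⌋)
open import Induction.WellFounded using (Acc; acc; WellFounded; module Subrelation)
open import Function.Bundles using (_⇔_)

record Signature : Set where
  field
    n        : ℕ
    size     : Fin n → ℕ
    nonempty : (v : Fin n) → 1 ≤ size v
open Signature public

Var : Signature → Set
Var σ = Fin (n σ)

Val : (σ : Signature) → Var σ → Set
Val σ v = Fin (size σ v)

Assignment : Signature → Set
Assignment σ = (v : Var σ) → Val σ v

-- an intervention X = x, as a partial assignment (X = its domain)
PAssign : Signature → Set
PAssign σ = (v : Var σ) → Maybe (Val σ v)

-- structural equation for an endogenous variable v:
-- a parent set PA_v and a function F_v : Ran(PA_v) → Ran(v)
record Mechanism (σ : Signature) (v : Var σ) : Set where
  field
    pa : Subset (n σ)
    fn : ((u : Var σ) → u ∈ pa → Val σ u) → Val σ v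
open Mechanism public

-- function component F: defined (just) exactly on endogenous variables
Fns : Signature → Set
Fns σ = (v : Var σ) → Maybe (Mechanism σ v)

Par : {σ : Signature} → Fns σ → Var σ → Var σ → Set
Par F u v = Σ _ λ m → F v ≡ just m × u ∈ pa m

restrict : {σ : Signature} → Fns σ → PAssign σ → Fns σ
restrict F x v with x v
... | just _  = nothing
... | nothing = F v

restrict-sub : {σ : Signature} (F : Fns σ) (x : PAssign σ) →
               ∀ {u v} → Par (restrict F x) u v → Par F u v
restrict-sub F x {u} {v} p with x v
restrict-sub F x {u} {v} (m , () , u∈) | just _
... | nothing = p

wf-restrict : {σ : Signature} (F : Fns σ) (x : PAssign σ) →
              WellFounded (Par F) → WellFounded (Par (restrict F x))
wf-restrict F x = Subrelation.wellFounded (restrict-sub F x)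

module _ {σ : Signature} (F : Fns σ) (x : PAssign σ) (s : Assignment σ) where
  doVal   : (v : Var σ) → Acc (Par F) v → Val σ v
  doVal-F : (v : Var σ) → (mm : Maybe (Mechanism σ v)) → F v ≡ mm →
            Acc (Par F) v → Val σ v
  doVal v a with x v
  ... | just b  = b
  ... | nothing = doVal-F v (F v) refl a
  doVal-F v nothing  eq a        = s v
  doVal-F v (just m) eq (acc rs) = fn m (λ u u∈ → doVal u (rs (m , eq , u∈)))

doAssign : {σ : Signature} (F : Fns σ) → WellFounded (Par F) →
           PAssign σ → Assignment σ → Assignment σ
doAssign F wf x s v = doVal F x s v (wf v)

-- Causal multiteams: a multiset of assignments (a list; all notions
-- below are invariant under permutation), a function component F with
-- acyclic (well-founded) causal graph.

record CMT (σ : Signature) : Set where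
  constructor cmt
  field
    team : List (Assignment σ)
    F    : Fns σ
    wf   : WellFounded (Par F)
open CMT public

Compatible : {σ : Signature} → Fns σ → Assignment σ → Set
Compatible {σ} F s = (v : Var σ) (m : Mechanism σ v) → F v ≡ just m →
                     s v ≡ fn m (λ u _ → s u)

IsCausalMultiteam : {σ : Signature} → CMT σ → Set
IsCausalMultiteam T = All (Compatible (F T)) (team T)

intervene : {σ : Signature} → CMT σ → PAssign σ → CMT σ
intervene (cmt t F wf) x =
  cmt (map (doAssign F wf x) t) (restrict F x) (wf-restrict F x wf)

data CO (σ : Signature) : Set where
  _≐_   : (Y : Var σ) → Val σ Y → CO σ
  _≠_   : (Y : Var σ) → Val σ Y → CO σ
  _∧ᶜ_  : CO σ → CO σ → CO σ
  _∨ᶜ_  : CO σ → CO σ → CO σ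
  _⊃ᶜ_  : CO σ → CO σ → CO σ
  _□→ᶜ_ : PAssign σ → CO σ → CO σ

evalCO : {σ : Signature} (F : Fns σ) → WellFounded (Par F) →
         Assignment σ → CO σ → Bool
evalCO F wf s (Y ≐ y)   = ⌊ s Y Data.Fin.≟ y ⌋
evalCO F wf s (Y ≠ y)   = not ⌊ s Y Data.Fin.≟ y ⌋
evalCO F wf s (α ∧ᶜ β)  = evalCO F wf s α ∧ evalCO F wf s β
evalCO F wf s (α ∨ᶜ β)  = evalCO F wf s α ∨ evalCO F wf s β
evalCO F wf s (α ⊃ᶜ β)  = not (evalCO F wf s α) ∨ evalCO F wf s β
evalCO F wf s (x □→ᶜ α) =
  evalCO (restrict F x) (wf-restrict F x wf) (doAssign F wf x s) α

count : {σ : Signature} → CMT σ → CO σ → ℕ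
count T α = length (filterᵇ (λ s → evalCO (F T) (wf T) s α) (team T))

-- P_T(α) = |T^α| / |T|   (only used when |T| ≠ 0)
ratio : ℕ → ℕ → ℚ
ratio k zero    = 0ℚ
ratio k (suc m) = (+ k) ℚ./ suc m

Pr : {σ : Signature} → CMT σ → CO σ → ℚ
Pr T α = ratio (count T α) (length (team T))

Empty : {σ : Signature} → CMT σ → Set
Empty T = length (team T) ≡ 0

Unit01 : Set
Unit01 = Σ ℚ λ ε → 0ℚ ℚ.≤ ε × ε ℚ.≤ 1ℚ

data PF (σ : Signature) : Set where
  _≐_     : (Y : Var σ) → Val σ Y → PF σ
  _≠_     : (Y : Var σ) → Val σ Y → PF σ
  Pr≥     : CO σ → Unit01 → PF σ
  Pr>     : CO σ → Unit01 → PF σ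
  Pr≥Pr   : CO σ → CO σ → PF σ
  Pr>Pr   : CO σ → CO σ → PF σ
  _∧ᵖ_    : PF σ → PF σ → PF σ
  _⊔_     : PF σ → PF σ → PF σ
  _□→_    : PAssign σ → PF σ → PF σ

infix 4 _⊨_
_⊨_ : {σ : Signature} → CMT σ → PF σ → Set
T ⊨ (Y ≐ y)     = All (λ s → s Y ≡ y) (team T)
T ⊨ (Y ≠ y)     = All (λ s → s Y ≢ y) (team T)
T ⊨ Pr≥ α (ε , _) = Empty T ⊎ (ε ℚ.≤ Pr T α)
T ⊨ Pr> α (ε , _) = Empty T ⊎ (ε ℚ.< Pr T α)
T ⊨ Pr≥Pr α β   = Empty T ⊎ (Pr T β ℚ.≤ Pr T α)
T ⊨ Pr>Pr α β   = Empty T ⊎ (Pr T β ℚ.< Pr T α)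
T ⊨ (φ ∧ᵖ ψ)    = (T ⊨ φ) × (T ⊨ ψ)
T ⊨ (φ ⊔ ψ)     = (T ⊨ φ) ⊎ (T ⊨ ψ)
T ⊨ (x □→ φ)    = intervene T x ⊨ φ

Equivalent : {σ : Signature} → PF σ → PF σ → Set
Equivalent {σ} φ ψ = (T : CMT σ) → IsCausalMultiteam T → (T ⊨ φ) ⇔ (T ⊨ ψ)

CFOnlyInPr : {σ : Signature} → PF σ → Set
CFOnlyInPr (Y ≐ y)   = ⊤
CFOnlyInPr (Y ≠ y)   = ⊤
CFOnlyInPr (Pr≥ _ _) = ⊤
CFOnlyInPr (Pr> _ _) = ⊤
CFOnlyInPr (Pr≥Pr _ _) = ⊤
CFOnlyInPr (Pr>Pr _ _) = ⊤
CFOnlyInPr (φ ∧ᵖ ψ)  = CFOnlyInPr φ × CFOnlyInPr ψ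
CFOnlyInPr (φ ⊔ ψ)   = CFOnlyInPr φ × CFOnlyInPr ψ
CFOnlyInPr (_ □→ _)  = ⊥

-- A counterfactual commutes with ∧ and ⊔, and it can be moved inside a
-- probability atom: intervening maps the team pointwise, so the intervened
-- team has the same size and P_{T_{X=x}}(α) = P_T(X = x □→ α).  A literal
-- Y = y holds in a team iff Pr(Y = y) ≥ 1 (both hold vacuously in the empty
-- team), so it too becomes a probability atom once it sits under □→.
-- Eliminating □→ bottom-up then leaves it only inside probability atoms.
module Submission where

open import Defs
open import Data.Product using (∃; _×_; _,_)
open import Data.Product.Function.NonDependent.Propositional using (_×-⇔_)
open import Data.Sum using (_⊎_; inj₁; inj₂)
open import Data.Sum.Function.Propositional using (_⊎-⇔_)
open import Data.Unit using (tt)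
open import Data.Bool as Bool using (Bool; true; false)
open import Data.Nat using (ℕ; suc; _≤_)
import Data.Nat.Properties as ℕ
open import Data.List using (List; []; _∷_; map; length; filterᵇ)
open import Data.List.Properties using (length-map; length-filter; filter-all; filter-complete)
open import Data.List.Relation.Unary.All as All using (All)
open import Data.List.Relation.Unary.All.Properties using (all-filter)
open import Data.Integer using (+_; +≤+) renaming (_*_ to _*ℤ_; _≤_ to _≤ℤ_)
import Data.Integer.Properties as ℤ
import Data.Rational as ℚ
open import Data.Rational using (ℚ; 1ℚ)
import Data.Rational.Properties as ℚ
import Data.Rational.Unnormalised as ℚᵘ
import Data.Rational.Unnormalised.Properties as ℚᵘ
open import Relation.Binary.PropositionalEquality using (_≡_; refl; cong; cong₂; subst; sym)
open import Relation.Nullary.Decidable using (T?; toWitness; fromWitness; toWitnessFalse; fromWitnessFalse)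
open import Function using (_∘_)
open import Function.Bundles using (_⇔_; mk⇔; Equivalence)
import Function.Properties.Equivalence as ⇔

All-⇔ : {A : Set} {P Q : A → Set} → (∀ a → P a ⇔ Q a) → (xs : List A) → All P xs ⇔ All Q xs
All-⇔ P⇔Q xs = mk⇔ (All.map (Equivalence.to (P⇔Q _))) (All.map (Equivalence.from (P⇔Q _)))

length-filterᵇ-map : {A B : Set} (p : B → Bool) (f : A → B) (xs : List A) →
                     length (filterᵇ p (map f xs)) ≡ length (filterᵇ (p ∘ f) xs)
length-filterᵇ-map p f []       = refl
length-filterᵇ-map p f (x ∷ xs) with p (f x)
... | true  = cong suc (length-filterᵇ-map p f xs)
... | false = length-filterᵇ-map p f xs

All⇔length≤length-filterᵇ : {A : Set} (p : A → Bool) (xs : List A) →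
                           All (Bool.T ∘ p) xs ⇔ (length xs ≤ length (filterᵇ p xs))
All⇔length≤length-filterᵇ p xs = mk⇔
  (λ all → ℕ.≤-reflexive (sym (cong length (filter-all (T? ∘ p) all))))
  (λ ≤filter → subst (All (Bool.T ∘ p))
     (filter-complete (T? ∘ p) (ℕ.≤-antisym (length-filter (T? ∘ p) xs) ≤filter))
     (all-filter (T? ∘ p) xs))

1≤k/n⇔n≤k : (k m : ℕ) → (1ℚ ℚ.≤ (+ k) ℚ./ suc m) ⇔ (suc m ≤ k)
1≤k/n⇔n≤k k m = mk⇔
  (λ 1≤k/n → ≤ᵘ⇒≤ (ℚᵘ.≤-respʳ-≃ k/n≃ (ℚ.toℚᵘ-mono-≤ 1≤k/n)))
  (λ n≤k → ℚ.toℚᵘ-cancel-≤ (ℚᵘ.≤-respʳ-≃ (ℚᵘ.≃-sym k/n≃) (ℚᵘ.*≤* (≤⇒≤ᵘ n≤k))))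
  where
  k/n≃ : ℚ.toℚᵘ ((+ k) ℚ./ suc m) ℚᵘ.≃ ℚᵘ.mkℚᵘ (+ k) m
  k/n≃ = ℚ.toℚᵘ-fromℚᵘ (ℚᵘ.mkℚᵘ (+ k) m)
  ≤⇒≤ᵘ : suc m ≤ k → (+ 1) *ℤ (+ suc m) ≤ℤ (+ k) *ℤ (+ 1)
  ≤⇒≤ᵘ n≤k rewrite ℤ.*-identityˡ (+ suc m) | ℤ.*-identityʳ (+ k) = +≤+ n≤k
  ≤ᵘ⇒≤ : ℚᵘ.1ℚᵘ ℚᵘ.≤ ℚᵘ.mkℚᵘ (+ k) m → suc m ≤ k
  ≤ᵘ⇒≤ (ℚᵘ.*≤* le) rewrite ℤ.*-identityˡ (+ suc m) | ℤ.*-identityʳ (+ k) = ℤ.drop‿+≤+ le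

All⇔empty⊎1≤ratio : {A : Set} (p : A → Bool) (xs : List A) →
                    All (Bool.T ∘ p) xs ⇔ (length xs ≡ 0 ⊎ 1ℚ ℚ.≤ ratio (length (filterᵇ p xs)) (length xs))
All⇔empty⊎1≤ratio p []         = mk⇔ (λ _ → inj₁ refl) (λ _ → All.[])
All⇔empty⊎1≤ratio p xs@(_ ∷ _) = ⇔.trans (All⇔length≤length-filterᵇ p xs)
  (⇔.trans (⇔.sym (1≤k/n⇔n≤k _ _)) (mk⇔ inj₂ λ { (inj₁ ()) ; (inj₂ 1≤ratio) → 1≤ratio }))

empty⊎-cong : {l l' : ℕ} {p p' q q' : ℚ} (_R_ : ℚ → ℚ → Set) →
              l ≡ l' → p ≡ p' → q ≡ q' → (l ≡ 0 ⊎ p R q) ⇔ (l' ≡ 0 ⊎ p' R q')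
empty⊎-cong _ refl refl refl = ⇔.refl

one : Unit01
one = 1ℚ , ℚ.nonNegative⁻¹ 1ℚ , ℚ.≤-refl

module _ {σ : Signature} where

  certain : CO σ → PF σ
  certain α = Pr≥ α one

  All⇔⊨-certain : (T : CMT σ) (α : CO σ) →
                  All (λ s → Bool.T (evalCO (F T) (wf T) s α)) (team T) ⇔ (T ⊨ certain α)
  All⇔⊨-certain T α = All⇔empty⊎1≤ratio _ (team T)

  ⊨-≐⇔certain : (T : CMT σ) (Y : Var σ) (y : Val σ Y) → (T ⊨ Y ≐ y) ⇔ (T ⊨ certain (Y ≐ y))
  ⊨-≐⇔certain T Y y =
    ⇔.trans (All-⇔ (λ _ → mk⇔ fromWitness toWitness) (team T)) (All⇔⊨-certain T (Y ≐ y))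

  ⊨-≠⇔certain : (T : CMT σ) (Y : Var σ) (y : Val σ Y) → (T ⊨ Y ≠ y) ⇔ (T ⊨ certain (Y ≠ y))
  ⊨-≠⇔certain T Y y =
    ⇔.trans (All-⇔ (λ _ → mk⇔ fromWitnessFalse toWitnessFalse) (team T)) (All⇔⊨-certain T (Y ≠ y))

  length-intervene : (T : CMT σ) (x : PAssign σ) → length (team (intervene T x)) ≡ length (team T)
  length-intervene T x = length-map _ (team T)

  Pr-intervene : (T : CMT σ) (x : PAssign σ) (α : CO σ) → Pr (intervene T x) α ≡ Pr T (x □→ᶜ α)
  Pr-intervene T x α =
    cong₂ ratio (length-filterᵇ-map _ _ (team T)) (length-intervene T x)

  push□→ : PAssign σ → PF σ → PF σ
  push□→ x (Y ≐ y)     = certain (x □→ᶜ (Y ≐ y))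
  push□→ x (Y ≠ y)     = certain (x □→ᶜ (Y ≠ y))
  push□→ x (Pr≥ α ε)   = Pr≥ (x □→ᶜ α) ε
  push□→ x (Pr> α ε)   = Pr> (x □→ᶜ α) ε
  push□→ x (Pr≥Pr α β) = Pr≥Pr (x □→ᶜ α) (x □→ᶜ β)
  push□→ x (Pr>Pr α β) = Pr>Pr (x □→ᶜ α) (x □→ᶜ β)
  push□→ x (φ ∧ᵖ ψ)    = push□→ x φ ∧ᵖ push□→ x ψ
  push□→ x (φ ⊔ ψ)     = push□→ x φ ⊔ push□→ x ψ
  push□→ x (z □→ φ)    = x □→ (z □→ φ)   -- never reached: elim□→ only pushes into □→-free formulas

  push□→-CFOnlyInPr : (x : PAssign σ) (φ : PF σ) → CFOnlyInPr φ → CFOnlyInPr (push□→ x φ)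
  push□→-CFOnlyInPr x (Y ≐ y)     _       = tt
  push□→-CFOnlyInPr x (Y ≠ y)     _       = tt
  push□→-CFOnlyInPr x (Pr≥ α ε)   _       = tt
  push□→-CFOnlyInPr x (Pr> α ε)   _       = tt
  push□→-CFOnlyInPr x (Pr≥Pr α β) _       = tt
  push□→-CFOnlyInPr x (Pr>Pr α β) _       = tt
  push□→-CFOnlyInPr x (φ ∧ᵖ ψ)    (p , q) = push□→-CFOnlyInPr x φ p , push□→-CFOnlyInPr x ψ q
  push□→-CFOnlyInPr x (φ ⊔ ψ)     (p , q) = push□→-CFOnlyInPr x φ p , push□→-CFOnlyInPr x ψ q

  intervene-⊨-Pr≥ : (T : CMT σ) (x : PAssign σ) (α : CO σ) (ε : Unit01) →
                    (intervene T x ⊨ Pr≥ α ε) ⇔ (T ⊨ Pr≥ (x □→ᶜ α) ε)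
  intervene-⊨-Pr≥ T x α ε = empty⊎-cong ℚ._≤_ (length-intervene T x) refl (Pr-intervene T x α)

  ⊨-□→⇔push□→ : (T : CMT σ) (x : PAssign σ) (φ : PF σ) → (T ⊨ x □→ φ) ⇔ (T ⊨ push□→ x φ)
  ⊨-□→⇔push□→ T x (Y ≐ y)     =
    ⇔.trans (⊨-≐⇔certain (intervene T x) Y y) (intervene-⊨-Pr≥ T x (Y ≐ y) one)
  ⊨-□→⇔push□→ T x (Y ≠ y)     =
    ⇔.trans (⊨-≠⇔certain (intervene T x) Y y) (intervene-⊨-Pr≥ T x (Y ≠ y) one)
  ⊨-□→⇔push□→ T x (Pr≥ α ε)   = intervene-⊨-Pr≥ T x α ε
  ⊨-□→⇔push□→ T x (Pr> α _)   =
    empty⊎-cong ℚ._<_ (length-intervene T x) refl (Pr-intervene T x α)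
  ⊨-□→⇔push□→ T x (Pr≥Pr α β) =
    empty⊎-cong ℚ._≤_ (length-intervene T x) (Pr-intervene T x β) (Pr-intervene T x α)
  ⊨-□→⇔push□→ T x (Pr>Pr α β) =
    empty⊎-cong ℚ._<_ (length-intervene T x) (Pr-intervene T x β) (Pr-intervene T x α)
  ⊨-□→⇔push□→ T x (φ ∧ᵖ ψ)    = ⊨-□→⇔push□→ T x φ ×-⇔ ⊨-□→⇔push□→ T x ψ
  ⊨-□→⇔push□→ T x (φ ⊔ ψ)     = ⊨-□→⇔push□→ T x φ ⊎-⇔ ⊨-□→⇔push□→ T x ψ
  ⊨-□→⇔push□→ T x (z □→ φ)    = ⇔.refl

  elim□→ : PF σ → PF σ
  elim□→ (φ ∧ᵖ ψ) = elim□→ φ ∧ᵖ elim□→ ψ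
  elim□→ (φ ⊔ ψ)  = elim□→ φ ⊔ elim□→ ψ
  elim□→ (x □→ φ) = push□→ x (elim□→ φ)
  elim□→ φ        = φ

  elim□→-CFOnlyInPr : (φ : PF σ) → CFOnlyInPr (elim□→ φ)
  elim□→-CFOnlyInPr (Y ≐ y)     = tt
  elim□→-CFOnlyInPr (Y ≠ y)     = tt
  elim□→-CFOnlyInPr (Pr≥ α ε)   = tt
  elim□→-CFOnlyInPr (Pr> α ε)   = tt
  elim□→-CFOnlyInPr (Pr≥Pr α β) = tt
  elim□→-CFOnlyInPr (Pr>Pr α β) = tt
  elim□→-CFOnlyInPr (φ ∧ᵖ ψ)    = elim□→-CFOnlyInPr φ , elim□→-CFOnlyInPr ψ
  elim□→-CFOnlyInPr (φ ⊔ ψ)     = elim□→-CFOnlyInPr φ , elim□→-CFOnlyInPr ψ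
  elim□→-CFOnlyInPr (x □→ φ)    = push□→-CFOnlyInPr x (elim□→ φ) (elim□→-CFOnlyInPr φ)

  ⊨⇔⊨-elim□→ : (T : CMT σ) (φ : PF σ) → (T ⊨ φ) ⇔ (T ⊨ elim□→ φ)
  ⊨⇔⊨-elim□→ T (φ ∧ᵖ ψ)    = ⊨⇔⊨-elim□→ T φ ×-⇔ ⊨⇔⊨-elim□→ T ψ
  ⊨⇔⊨-elim□→ T (φ ⊔ ψ)     = ⊨⇔⊨-elim□→ T φ ⊎-⇔ ⊨⇔⊨-elim□→ T ψ
  ⊨⇔⊨-elim□→ T (x □→ φ)    = ⇔.trans (⊨⇔⊨-elim□→ (intervene T x) φ) (⊨-□→⇔push□→ T x (elim□→ φ))
  ⊨⇔⊨-elim□→ T (Y ≐ y)     = ⇔.refl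
  ⊨⇔⊨-elim□→ T (Y ≠ y)     = ⇔.refl
  ⊨⇔⊨-elim□→ T (Pr≥ α ε)   = ⇔.refl
  ⊨⇔⊨-elim□→ T (Pr> α ε)   = ⇔.refl
  ⊨⇔⊨-elim□→ T (Pr≥Pr α β) = ⇔.refl
  ⊨⇔⊨-elim□→ T (Pr>Pr α β) = ⇔.refl

lemma9 : {σ : Signature} (φ : PF σ) →
         ∃ λ (φ' : PF σ) → CFOnlyInPr φ' × Equivalent φ φ'
lemma9 φ = elim□→ φ , elim□→-CFOnlyInPr φ , λ T _ → ⊨⇔⊨-elim□→ T φ
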